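{- There exist a family $\{\mathcal{T}_n\}_{n\in\mathbb{N}}$ of finite transition systems and a family $\{\varphi_n\}_{n\in\mathbb{N}}$ of HyperLTL formulas of the form $\forall\pi.\exists\pi'.\,\phi_n$ such that $\mathcal{T}_n$ has $\Theta(n)$ states, $\phi_n$ is a safety property, $\varphi_n$ has size $\Theta(n)$, $\mathcal{T}_n\models\varphi_n$, and any family of prophecy sets $\{\Xi_n\}_{n\in\mathbb{N}}$ where each $\Xi_n$ is complete for $\mathcal{T}_n,\varphi_n$ satisfies $|\Xi_n|\in\Omega(\log n)$.
   Context: Transition systems $\mathcal{T}=(S,S_0,\varrho,L)$ with finite $S$, total $\varrho$, labelling into $2^{\mathit{AP}}$; HyperLTL trace quantifiers range over label sequences of infinite paths from $S_0$. A prophecy set $\Xi=\{\xi_1,..,\xi_n\}$ is a finite set of QPTL formulas (LTL with propositional quantification) over the universally quantified trace variable $\pi$. For fresh $P=\{p_1,..,p_n\}$, $\mathcal{T}^P=(S\times2^P,S_0\times2^P,\varrho^P,L^P)$ with $((s,A),(s',A'))\in\varrho^P$ iff $(s,s')\in\varrho$ and $L^P(s,A)=L(s)\cup A$; $\varphi^{P,\Xi}=\forall\pi.\exists\pi'.[\mathsf{G}\bigwedge_j((p_j)_\pi\leftrightarrow\xi_j)]\to\phi$. Game $\mathcal{G}(\mathcal{T}',\psi)$ for $\psi=\forall\pi.\exists\pi'.\chi$: with a deterministic parity automaton for $\chi$ over pairs of letters, the refuter picks an initial state, the verifier picks an initial state, then alternately the refuter advances its state by a transition (the automaton reads the current label pair)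 and the verifier advances its state; the verifier wins iff the minimal colour seen infinitely often is even. $\Xi$ is complete for $\mathcal{T},\varphi$ if the verifier wins $\mathcal{G}(\mathcal{T}^P,\varphi^{P,\Xi})$ from every initial choice of the refuter. -}

module Defs where

open import Data.Nat using (ℕ; zero; suc; _+_; _*_; _≤_; _<_)
open import Data.Nat.Logarithm using (⌊log₂_⌋)
open import Data.Fin using (Fin; zero; suc; toℕ)
open import Data.Bool using (Bool; true; false)
open import Data.Product using (Σ; ∃; _×_; _,_; proj₁; proj₂)
open import Data.Sum using (_⊎_; inj₁; inj₂)
open import Data.Unit using (⊤)
open import Data.Vec using (Vec; tabulate)
open import Function using (_∘_)
open import Function.Definitions using (Injective)
open import Relation.Nullary using (¬_)
open import Relation.Binary.PropositionalEquality using (_≡_)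

record TS (AP : Set) : Set₁ where
  field
    State : Set
    Init  : State → Set
    Trans : State → State → Set
    Label : State → AP → Bool      -- L(s) ⊆ AP as characteristic function

record FTS (a : ℕ) : Set where
  field
    nStates : ℕ
    init    : Fin nStates → Bool
    trans   : Fin nStates → Fin nStates → Bool
    label   : Fin nStates → Fin a → Bool
    total   : ∀ s → ∃ λ s' → trans s s' ≡ true

toTS : ∀ {a} → FTS a → TS (Fin a)
toTS T = record
  { State = Fin (FTS.nStates T)
  ; Init  = λ s → FTS.init T s ≡ true
  ; Trans = λ s s' → FTS.trans T s s' ≡ true
  ; Label = FTS.label T
  }

-- Infinite words over the alphabet 2^B
Word : Set → Set
Word B = ℕ → B → Bool

record Path {AP : Set} (T : TS AP) : Set where
  field
    st    : ℕ → TS.State T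
    start : TS.Init T (st 0)
    step  : ∀ i → TS.Trans T (st i) (st (suc i))

trace : ∀ {AP} {T : TS AP} → Path T → Word AP
trace {T = T} p i = TS.Label T (Path.st p i)

-- Trace variables: zero = π (universal), suc zero = π' (existential)
zipW : ∀ {AP : Set} → Word AP → Word AP → Word (AP × Fin 2)
zipW w₁ w₂ i (x , zero)     = w₁ i x
zipW w₁ w₂ i (x , suc _)    = w₂ i x

data LTL (A : Set) : Set where
  tt   : LTL A
  prop : A → LTL A
  ¬ₗ_  : LTL A → LTL A
  _∧ₗ_ : LTL A → LTL A → LTL A
  Xₗ   : LTL A → LTL A
  _Uₗ_ : LTL A → LTL A → LTL A

sizeL : ∀ {A} → LTL A → ℕ
sizeL tt         = 1
sizeL (prop _)   = 1
sizeL (¬ₗ φ)     = suc (sizeL φ)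
sizeL (φ ∧ₗ ψ)   = suc (sizeL φ + sizeL ψ)
sizeL (Xₗ φ)     = suc (sizeL φ)
sizeL (φ Uₗ ψ)   = suc (sizeL φ + sizeL ψ)

satL : ∀ {A} → Word A → ℕ → LTL A → Set
satL w i tt        = ⊤
satL w i (prop x)  = w i x ≡ true
satL w i (¬ₗ φ)    = ¬ satL w i φ
satL w i (φ ∧ₗ ψ)  = satL w i φ × satL w i ψ
satL w i (Xₗ φ)    = satL w (suc i) φ
satL w i (φ Uₗ ψ)  = ∃ λ k → i ≤ k × satL w k ψ × (∀ j → i ≤ j → j < k → satL w j φ)

renameL : ∀ {A B} → (A → B) → LTL A → LTL B
renameL f tt       = tt
renameL f (prop x) = prop (f x)
renameL f (¬ₗ φ)   = ¬ₗ (renameL f φ)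
renameL f (φ ∧ₗ ψ) = renameL f φ ∧ₗ renameL f ψ
renameL f (Xₗ φ)   = Xₗ (renameL f φ)
renameL f (φ Uₗ ψ) = renameL f φ Uₗ renameL f ψ

-- HyperLTL formulas of the form ∀π.∃π'.ϕ : represented by the body ϕ,
-- an LTL formula over indexed propositions AP × {π, π'}

-- size of ∀π.∃π'.ϕ (two quantifiers plus the body)
sizeAE : ∀ {A} → LTL (A × Fin 2) → ℕ
sizeAE ϕ = 2 + sizeL ϕ

ModelsAE : ∀ {AP} → TS AP → LTL (AP × Fin 2) → Set
ModelsAE T ϕ = (p : Path T) → ∃ λ (q : Path T) → satL (zipW (trace p) (trace q)) 0 ϕ

Safety : ∀ {B} → LTL B → Set
Safety {B} ϕ = (w : Word B) → ¬ satL w 0 ϕ →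
  ∃ λ i → (w' : Word B) → (∀ j → j < i → ∀ b → w' j b ≡ w j b) → ¬ satL w' 0 ϕ

-- QPTL (LTL with propositional quantification); n = number of bound
-- propositional variables in scope (de Bruijn, Fin n)

data QPTL (A : Set) : ℕ → Set where
  tt   : ∀ {n} → QPTL A n
  prop : ∀ {n} → A → QPTL A n
  var  : ∀ {n} → Fin n → QPTL A n
  ¬q_  : ∀ {n} → QPTL A n → QPTL A n
  _∧q_ : ∀ {n} → QPTL A n → QPTL A n → QPTL A n
  Xq   : ∀ {n} → QPTL A n → QPTL A n
  _Uq_ : ∀ {n} → QPTL A n → QPTL A n → QPTL A n
  ∃q   : ∀ {n} → QPTL A (suc n) → QPTL A n

extend : ∀ {n} → (ℕ → Bool) → (Fin n → ℕ → Bool) → Fin (suc n) → ℕ → Bool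
extend q env zero    = q
extend q env (suc x) = env x

satQ : ∀ {A n} → Word A → (Fin n → ℕ → Bool) → ℕ → QPTL A n → Set
satQ w env i tt        = ⊤
satQ w env i (prop x)  = w i x ≡ true
satQ w env i (var x)   = env x i ≡ true
satQ w env i (¬q φ)    = ¬ satQ w env i φ
satQ w env i (φ ∧q ψ)  = satQ w env i φ × satQ w env i ψ
satQ w env i (Xq φ)    = satQ w env (suc i) φ
satQ w env i (φ Uq ψ)  = ∃ λ k → i ≤ k × satQ w env k ψ × (∀ j → i ≤ j → j < k → satQ w env j φ)
satQ w env i (∃q φ)    = ∃ λ (q : ℕ → Bool) → satQ w (extend q env) i φ

noEnv : Fin 0 → ℕ → Bool
noEnv ()

renameQ : ∀ {A B n} → (A → B) → QPTL A n → QPTL B n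
renameQ f tt       = tt
renameQ f (prop x) = prop (f x)
renameQ f (var x)  = var x
renameQ f (¬q φ)   = ¬q (renameQ f φ)
renameQ f (φ ∧q ψ) = renameQ f φ ∧q renameQ f ψ
renameQ f (Xq φ)   = Xq (renameQ f φ)
renameQ f (φ Uq ψ) = renameQ f φ Uq renameQ f ψ
renameQ f (∃q φ)   = ∃q (renameQ f φ)

ltl→qptl : ∀ {A n} → LTL A → QPTL A n
ltl→qptl tt       = tt
ltl→qptl (prop x) = prop x
ltl→qptl (¬ₗ φ)   = ¬q (ltl→qptl φ)
ltl→qptl (φ ∧ₗ ψ) = ltl→qptl φ ∧q ltl→qptl ψ
ltl→qptl (Xₗ φ)   = Xq (ltl→qptl φ)
ltl→qptl (φ Uₗ ψ) = ltl→qptl φ Uq ltl→qptl ψ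

_⇒q_ : ∀ {A n} → QPTL A n → QPTL A n → QPTL A n
φ ⇒q ψ = ¬q (φ ∧q (¬q ψ))

_⇔q_ : ∀ {A n} → QPTL A n → QPTL A n → QPTL A n
φ ⇔q ψ = (φ ⇒q ψ) ∧q (ψ ⇒q φ)

Gq : ∀ {A n} → QPTL A n → QPTL A n
Gq φ = ¬q (tt Uq (¬q φ))

⋀q : ∀ {A n m} → (Fin m → QPTL A n) → QPTL A n
⋀q {m = zero}  f = tt
⋀q {m = suc m} f = f zero ∧q ⋀q (f ∘ suc)

-- A prophecy set Ξ = {ξ₁,…,ξₘ}: closed QPTL formulas over π (atoms AP),
-- given as an injective enumeration (so m = |Ξ|)
record Prophecies (a : ℕ) : Set where
  field
    card : ℕ
    ξ    : Fin card → QPTL (Fin a) 0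
    inj  : Injective _≡_ _≡_ ξ

prophExt : ∀ {AP} → TS AP → (m : ℕ) → TS (AP ⊎ Fin m)
prophExt T m = record
  { State = TS.State T × (Fin m → Bool)
  ; Init  = λ sA → TS.Init T (proj₁ sA)
  ; Trans = λ sA sA' → TS.Trans T (proj₁ sA) (proj₁ sA')
  ; Label = lab
  }
  where
  lab : TS.State T × (Fin m → Bool) → _ ⊎ Fin m → Bool
  lab (s , A) (inj₁ x) = TS.Label T s x
  lab (s , A) (inj₂ j) = A j

prophBody : ∀ {a} (Ξ : Prophecies a) → LTL (Fin a × Fin 2) →
            QPTL ((Fin a ⊎ Fin (Prophecies.card Ξ)) × Fin 2) 0
prophBody Ξ ϕ =
  Gq (⋀q (λ j → prop (inj₂ j , zero) ⇔q renameQ (λ x → (inj₁ x , zero)) (Prophecies.ξ Ξ j)))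
  ⇒q ltl→qptl (renameL (λ xt → (inj₁ (proj₁ xt) , proj₂ xt)) ϕ)

-- The game G(T', ∀π.∃π'.χ): the refuter builds a path r (choosing r 0, then
-- r (i+1)); after each refuter move the verifier chooses its next state,
-- depending on the refuter's moves so far.  The verifier wins a play iff the
-- pair of traces satisfies χ (= acceptance by the deterministic parity
-- automaton for χ).

prefix : ∀ {S : Set} → (ℕ → S) → (i : ℕ) → Vec S (suc i)
prefix r i = tabulate (λ j → r (toℕ j))

VerifierStrategy : Set → Set
VerifierStrategy S = (i : ℕ) → Vec S (suc i) → S

VerifierWins : ∀ {B} (T : TS B) → QPTL (B × Fin 2) 0 → TS.State T → Set
VerifierWins T χ s₀ =
  ∃ λ (σ : VerifierStrategy (TS.State T)) →
    (r : ℕ → TS.State T) → r 0 ≡ s₀ → (∀ i → TS.Trans T (r i) (r (suc i))) →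
      let t = λ i → σ i (prefix r i) in
      TS.Init T (t 0)
      × (∀ i → TS.Trans T (t i) (t (suc i)))
      × satQ (zipW (TS.Label T ∘ r) (TS.Label T ∘ t)) noEnv 0 χ

Complete : ∀ {a} → FTS a → LTL (Fin a × Fin 2) → Prophecies a → Set
Complete T ϕ Ξ =
  let T' = prophExt (toTS T) (Prophecies.card Ξ) in
  (s₀ : TS.State T') → TS.Init T' s₀ → VerifierWins T' (prophBody Ξ ϕ) s₀

ThetaN : (ℕ → ℕ) → Set
ThetaN f = ∃ λ c → ∃ λ N → ∀ n → N ≤ n → f n ≤ c * n × n ≤ c * f n

OmegaLog : (ℕ → ℕ) → Set
OmegaLog f = ∃ λ c → ∃ λ N → ∀ n → N ≤ n → ⌊log₂ n ⌋ ≤ c * f n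

{-# OPTIONS --safe #-}

-- Tₙ has a blank state and states labelled {0}, …, {n-1}, all initial and all
-- connected; ϕₙ demands that π′ carries at time 0 the label π carries at time 1,
-- so the verifier has to guess the refuter's next state before it is played.
-- In the prophecy game the refuter starts in the blank state with a prophecy
-- valuation B.  If two labels k ≠ l make Ξ true at the same prophecies on the
-- trace ∅{k}{k}…, the refuter may continue with either k or l keeping all
-- prophecies correct, and the verifier's single first move cannot be right for
-- both.  So k ↦ (truth values of Ξ at time 0) is injective, n ≤ 2^|Ξ|, and
-- |Ξ| ≥ log₂ n.  Those truth values exist only under a double negation, which
-- is harmless because n ≤ 2^|Ξ| is decidable.
module Submission where

open import Defs
open import Data.Nat using (ℕ; zero; suc; _+_; _*_; _∸_; _^_; _≤_; _<_; _≤?_; z≤n; s≤s)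
open import Data.Nat.Properties hiding (_≟_)
open import Data.Nat.Logarithm using (⌊log₂_⌋; ⌊log₂⌋-mono-≤; ⌊log₂[2^n]⌋≡n)
open import Data.Fin using (Fin; zero; suc; toℕ; _≟_; funToFin; finToFun)
open import Data.Fin.Properties using (injective⇒≤; finToFun-funToFin)
open import Data.Bool using (Bool; true; false)
import Data.Bool as Bool
open import Data.Product using (∃; _×_; _,_; proj₁; proj₂)
open import Data.Product.Function.NonDependent.Propositional using (_×-⇔_)
open import Data.Sum using (_⊎_; inj₁; inj₂)
open import Data.Empty using (⊥-elim)
open import Data.Unit using (⊤)
open import Data.Vec using (_∷_; [])
open import Function using (_∘_; id; const)
open import Function.Bundles using (_⇔_; mk⇔; Equivalence)
import Function.Properties.Equivalence as ⇔
open import Relation.Nullary using (¬_; Dec; does; yes; no)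
open import Relation.Nullary.Negation using (contraposition; ¬¬-map)
open import Relation.Nullary.Decidable using (dec-true; decidable-stable; ¬¬-excluded-middle)
open import Relation.Binary.PropositionalEquality
  using (_≡_; refl; sym; trans; cong; cong₂; subst; subst₂; module ≡-Reasoning)

open Equivalence using (to; from)

does-true⇔ : ∀ {P : Set} (d : Dec P) → does d ≡ true ⇔ P
does-true⇔ (yes p) = mk⇔ (const p) (const refl)
does-true⇔ (no ¬p) = mk⇔ (λ ()) (λ p → ⊥-elim (¬p p))

¬¬-Π-Fin : ∀ m {P : Fin m → Set} → (∀ i → ¬ ¬ P i) → ¬ ¬ (∀ i → P i)
¬¬-Π-Fin zero    _    k = k (λ ())
¬¬-Π-Fin (suc m) ¬¬P k =
  ¬¬P zero λ P₀ → ¬¬-Π-Fin m (¬¬P ∘ suc) λ Pₛ → k λ { zero → P₀ ; (suc i) → Pₛ i }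

bit : Bool → Fin 2
bit false = zero
bit true  = suc zero

bit-injective : ∀ a b → bit a ≡ bit b → a ≡ b
bit-injective false false _ = refl
bit-injective true  true  _ = refl

pointwise-injective⇒≤2^ : ∀ {n c} (f : Fin n → Fin c → Bool) →
  (∀ k l → (∀ j → f k j ≡ f l j) → k ≡ l) → n ≤ 2 ^ c
pointwise-injective⇒≤2^ f f-inj =
  injective⇒≤ {f = λ k → funToFin (bit ∘ f k)} λ {k} {l} eq → f-inj k l λ j →
    bit-injective _ _ (begin
      bit (f k j)                          ≡⟨ finToFun-funToFin (bit ∘ f k) j ⟨
      finToFun (funToFin (bit ∘ f k)) j    ≡⟨ cong (λ i → finToFun i j) eq ⟩
      finToFun (funToFin (bit ∘ f l)) j    ≡⟨ finToFun-funToFin (bit ∘ f l) j ⟩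
      bit (f l j)                          ∎)
  where open ≡-Reasoning

Until : ℕ → (ℕ → Set) → (ℕ → Set) → Set
Until i P Q = ∃ λ k → i ≤ k × Q k × (∀ j → i ≤ j → j < k → P j)

Until-shift : ∀ {P Q P′ Q′ : ℕ → Set} p p′ →
  (∀ d → P (p + d) → P′ (p′ + d)) → (∀ d → Q (p + d) → Q′ (p′ + d)) →
  ∀ d → Until (p + d) P Q → Until (p′ + d) P′ Q′
Until-shift {Q = Q} {P′} p p′ P→P′ Q→Q′ d (k , p+d≤k , Qk , P<k) =
  p′ + e , +-monoʳ-≤ p′ d≤e , Q→Q′ e (subst Q k≡p+e Qk) , P′<p′+e
  where
  e = k ∸ p
  k≡p+e : k ≡ p + e
  k≡p+e = sym (m+[n∸m]≡n (m+n≤o⇒m≤o p p+d≤k))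
  d≤e : d ≤ e
  d≤e = +-cancelˡ-≤ p d e (subst (p + d ≤_) k≡p+e p+d≤k)
  P′<p′+e : ∀ j → p′ + d ≤ j → j < p′ + e → P′ j
  P′<p′+e j p′+d≤j j<p′+e = subst P′ (sym j≡p′+i) (P→P′ i (P<k (p + i) p+d≤p+i p+i<k))
    where
    i = j ∸ p′
    j≡p′+i : j ≡ p′ + i
    j≡p′+i = sym (m+[n∸m]≡n (m+n≤o⇒m≤o p′ p′+d≤j))
    p+d≤p+i : p + d ≤ p + i
    p+d≤p+i = +-monoʳ-≤ p (+-cancelˡ-≤ p′ d i (subst (p′ + d ≤_) j≡p′+i p′+d≤j))
    p+i<k : p + i < k
    p+i<k = subst (p + i <_) (sym k≡p+e)
      (+-monoʳ-< p (+-cancelˡ-< p′ i e (subst (_< p′ + e) j≡p′+i j<p′+e)))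

EnvAgree : ∀ {n} → (Fin n → ℕ → Bool) → ℕ → (Fin n → ℕ → Bool) → ℕ → Set
EnvAgree E p e p′ = ∀ y d → E y (p + d) ≡ e y (p′ + d)

reindex : ℕ → ℕ → (ℕ → Bool) → ℕ → Bool
reindex p p′ q t = q (p + (t ∸ p′))

reindex-at : ∀ p p′ (q : ℕ → Bool) d → reindex p p′ q (p′ + d) ≡ q (p + d)
reindex-at p p′ q d = cong (λ i → q (p + i)) (m+n∸m≡n p′ d)

EnvAgree-extend : ∀ {n} {E e : Fin n → ℕ → Bool} {p p′} {q q′ : ℕ → Bool} →
  (∀ d → q (p + d) ≡ q′ (p′ + d)) → EnvAgree E p e p′ →
  EnvAgree (extend q E) p (extend q′ e) p′
EnvAgree-extend q≈q′ E≈e zero    = q≈q′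
EnvAgree-extend q≈q′ E≈e (suc y) = E≈e y

module _ {A B : Set} (f : A → B) {W : Word B} {w : Word A} {p p′ : ℕ}
         (W≈w : ∀ d x → W (p + d) (f x) ≡ w (p′ + d) x) where

  satQ-renameQ : ∀ {n} {E e : Fin n → ℕ → Bool} → EnvAgree E p e p′ →
    ∀ φ d → satQ W E (p + d) (renameQ f φ) ⇔ satQ w e (p′ + d) φ
  satQ-renameQ E≈e tt       d = mk⇔ _ _
  satQ-renameQ E≈e (prop x) d = mk⇔ (trans (sym (W≈w d x))) (trans (W≈w d x))
  satQ-renameQ E≈e (var y)  d = mk⇔ (trans (sym (E≈e y d))) (trans (E≈e y d))
  satQ-renameQ E≈e (¬q φ)   d =
    mk⇔ (contraposition (from ih)) (contraposition (to ih))
    where ih = satQ-renameQ E≈e φ d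
  satQ-renameQ E≈e (φ ∧q ψ) d = satQ-renameQ E≈e φ d ×-⇔ satQ-renameQ E≈e ψ d
  satQ-renameQ {E = E} {e} E≈e (Xq φ) d =
    subst₂ (λ i i′ → satQ W E i (renameQ f φ) ⇔ satQ w e i′ φ)
      (+-suc p d) (+-suc p′ d) (satQ-renameQ E≈e φ (suc d))
  satQ-renameQ E≈e (φ Uq ψ) d =
    mk⇔ (Until-shift p p′ (to ∘ ih φ) (to ∘ ih ψ) d)
        (Until-shift p′ p (from ∘ ih φ) (from ∘ ih ψ) d)
    where ih = λ χ → satQ-renameQ E≈e χ
  satQ-renameQ E≈e (∃q φ)   d =
    mk⇔ (λ (q , s) → reindex p p′ q ,
           to (satQ-renameQ (EnvAgree-extend (sym ∘ reindex-at p p′ q) E≈e) φ d) s)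
        (λ (q , s) → reindex p′ p q ,
           from (satQ-renameQ (EnvAgree-extend (reindex-at p′ p q) E≈e) φ d) s)

  satQ-renameQ₀ : ∀ {n} {E e : Fin n → ℕ → Bool} → EnvAgree E p e p′ →
    ∀ φ → satQ W E p (renameQ f φ) ⇔ satQ w e p′ φ
  satQ-renameQ₀ {E = E} {e} E≈e φ =
    subst₂ (λ i i′ → satQ W E i (renameQ f φ) ⇔ satQ w e i′ φ)
      (+-identityʳ p) (+-identityʳ p′) (satQ-renameQ E≈e φ 0)

⋀ₗ : ∀ {A : Set} {m} → (Fin m → LTL A) → LTL A
⋀ₗ {m = zero}  f = tt
⋀ₗ {m = suc m} f = f zero ∧ₗ ⋀ₗ (f ∘ suc)

satL-⋀ₗ : ∀ {A : Set} {m} {w : Word A} {i} (f : Fin m → LTL A) →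
  satL w i (⋀ₗ f) ⇔ (∀ j → satL w i (f j))
satL-⋀ₗ {m = zero}  f = mk⇔ (λ _ ()) _
satL-⋀ₗ {m = suc m} f = mk⇔
  (λ { (s₀ , sₛ) zero → s₀ ; (s₀ , sₛ) (suc j) → to (satL-⋀ₗ (f ∘ suc)) sₛ j })
  (λ s → s zero , from (satL-⋀ₗ (f ∘ suc)) (s ∘ suc))

satQ-⋀q : ∀ {A : Set} {n m} {w : Word A} {E : Fin n → ℕ → Bool} {i} (f : Fin m → QPTL A n) →
  satQ w E i (⋀q f) ⇔ (∀ j → satQ w E i (f j))
satQ-⋀q {m = zero}  f = mk⇔ (λ _ ()) _
satQ-⋀q {m = suc m} f = mk⇔
  (λ { (s₀ , sₛ) zero → s₀ ; (s₀ , sₛ) (suc j) → to (satQ-⋀q (f ∘ suc)) sₛ j })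
  (λ s → s zero , from (satQ-⋀q (f ∘ suc)) (s ∘ suc))

satQ-⇔q : ∀ {A : Set} {n} {w : Word A} {E : Fin n → ℕ → Bool} {i} (φ ψ : QPTL A n) →
  satQ w E i φ ⇔ satQ w E i ψ → satQ w E i (φ ⇔q ψ)
satQ-⇔q _ _ φ⇔ψ =
  (λ (sφ , ¬sψ) → ¬sψ (to φ⇔ψ sφ)) , (λ (sψ , ¬sφ) → ¬sφ (from φ⇔ψ sψ))

ltl→qptl-renameL-⋀ₗ : ∀ {A B : Set} {n m} (h : A → B) (f : Fin m → LTL A) →
  ltl→qptl {n = n} (renameL h (⋀ₗ f)) ≡ ⋀q (ltl→qptl ∘ renameL h ∘ f)
ltl→qptl-renameL-⋀ₗ {m = zero}  h f = refl
ltl→qptl-renameL-⋀ₗ {m = suc m} h f =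
  cong (ltl→qptl (renameL h (f zero)) ∧q_) (ltl→qptl-renameL-⋀ₗ h (f ∘ suc))

sizeL-⋀ₗ : ∀ {A : Set} {m s} (f : Fin m → LTL A) → (∀ i → sizeL (f i) ≡ s) →
  sizeL (⋀ₗ f) ≡ 1 + m * suc s
sizeL-⋀ₗ {m = zero}      f _    = refl
sizeL-⋀ₗ {m = suc m} {s} f size = begin
  suc (sizeL (f zero) + sizeL (⋀ₗ (f ∘ suc)))
    ≡⟨ cong₂ (λ a b → suc (a + b)) (size zero) (sizeL-⋀ₗ (f ∘ suc) (size ∘ suc)) ⟩
  suc (s + suc (m * suc s))                   ≡⟨ cong suc (+-suc s (m * suc s)) ⟩
  1 + suc m * suc s                           ∎
  where open ≡-Reasoning

ThetaN-cong : ∀ {f g : ℕ → ℕ} → (∀ n → f n ≡ g n) → ThetaN f → ThetaN g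
ThetaN-cong f≡g (c , N , bound) = c , N , λ n N≤n →
  subst (λ x → x ≤ c * n × n ≤ c * x) (f≡g n) (bound n N≤n)

ThetaN-affine : ∀ a b → ThetaN (λ n → a + n * suc b)
ThetaN-affine a b = suc b + a , 1 , bounds
  where
  c = suc b + a
  bounds : ∀ n → 1 ≤ n → a + n * suc b ≤ c * n × n ≤ c * (a + n * suc b)
  bounds n@(suc _) _ = upper , lower
    where
    open ≤-Reasoning
    upper : a + n * suc b ≤ c * n
    upper = begin
      a + n * suc b     ≤⟨ +-monoˡ-≤ (n * suc b) (m≤m*n a n) ⟩
      a * n + n * suc b ≡⟨ +-comm (a * n) (n * suc b) ⟩
      n * suc b + a * n ≡⟨ cong (_+ a * n) (*-comm n (suc b)) ⟩
      suc b * n + a * n ≡⟨ *-distribʳ-+ n (suc b) a ⟨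
      c * n             ∎
    lower : n ≤ c * (a + n * suc b)
    lower = begin
      n                 ≤⟨ m≤m*n n (suc b) ⟩
      n * suc b         ≤⟨ m≤n+m (n * suc b) a ⟩
      a + n * suc b     ≤⟨ m≤n*m (a + n * suc b) c ⟩
      c * (a + n * suc b) ∎

singleton : ∀ {n} → Fin (suc n) → Fin n → Bool
singleton zero    _ = false
singleton (suc i) x = does (i ≟ x)

singleton-self : ∀ {n} (k : Fin n) → singleton (suc k) k ≡ true
singleton-self k = dec-true (k ≟ k) refl

singleton-unique : ∀ {n} (s : Fin (suc n)) {x y} →
  singleton s x ≡ true → singleton s y ≡ true → x ≡ y
singleton-unique (suc i) {x} {y} sx sy =
  trans (sym (to (does-true⇔ (i ≟ x)) sx)) (to (does-true⇔ (i ≟ y)) sy)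

Tₙ : (n : ℕ) → FTS n
Tₙ n = record
  { nStates = suc n
  ; init    = λ _ → true
  ; trans   = λ _ _ → true
  ; label   = singleton
  ; total   = λ s → s , refl
  }

predictsNext : ∀ {n} → Fin n → LTL (Fin n × Fin 2)
predictsNext i = ¬ₗ (Xₗ (prop (i , zero)) ∧ₗ (¬ₗ prop (i , suc zero)))

ϕₙ : (n : ℕ) → LTL (Fin n × Fin 2)
ϕₙ n = ⋀ₗ predictsNext

ϕₙ-safety : ∀ n → Safety (ϕₙ n)
ϕₙ-safety n w ¬w⊨ϕ = 2 , λ w′ w′≈w w′⊨ϕ →
  ¬w⊨ϕ (from (satL-⋀ₗ {m = n} predictsNext) λ i (next , ¬now) →
    to (satL-⋀ₗ {m = n} predictsNext) w′⊨ϕ i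
      ( trans (w′≈w 1 (s≤s (s≤s z≤n)) _) next
      , λ now → ¬now (trans (sym (w′≈w 0 (s≤s z≤n) _)) now)))

Tₙ⊨ϕₙ : ∀ n → ModelsAE (toTS (Tₙ n)) (ϕₙ n)
Tₙ⊨ϕₙ n p = ahead , from (satL-⋀ₗ {m = n} predictsNext) λ i (next , ¬now) → ¬now next
  where
  ahead : Path (toTS (Tₙ n))
  ahead = record { st = Path.st p ∘ suc ; start = refl ; step = λ _ → refl }

module LowerBound (n : ℕ) (Ξ : Prophecies n) (complete : Complete (Tₙ n) (ϕₙ n) Ξ) where
  open Prophecies Ξ using (ξ) renaming (card to c)

  T^P : TS (Fin n ⊎ Fin c)
  T^P = prophExt (toTS (Tₙ n)) c

  visit : Fin n → ℕ → Fin (suc n)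
  visit k zero    = zero
  visit k (suc _) = suc k

  TruthTable : Set
  TruthTable = ∀ k j (i : Fin 2) → Dec (satQ (singleton ∘ visit k) noEnv (toℕ i) (ξ j))

  ¬¬truthTable : ¬ ¬ TruthTable
  ¬¬truthTable = ¬¬-Π-Fin n λ k → ¬¬-Π-Fin c λ j → ¬¬-Π-Fin 2 λ i → ¬¬-excluded-middle

  module _ (table : TruthTable) where
    now later : Fin n → Fin c → Bool
    now   k j = does (table k j zero)
    later k j = does (table k j (suc zero))

    play : Fin n → (Fin c → Bool) → ℕ → TS.State T^P
    play k B zero    = zero , B
    play k B (suc _) = suc k , later k

    verifier-predicts : ∀ k B (t : ℕ → TS.State T^P) → (∀ j → B j ≡ now k j) →
      satQ (zipW (TS.Label T^P ∘ play k B) (TS.Label T^P ∘ t)) noEnv 0 (prophBody Ξ (ϕₙ n)) →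
      singleton (proj₁ (t 0)) k ≡ true
    verifier-predicts k B t B≈now sat =
      decidable-stable (singleton (proj₁ (t 0)) k Bool.≟ true) λ unseen →
        sat (prophecies-hold , λ ϕ-holds →
          to (satQ-⋀q predictsNext′)
             (subst (satQ W noEnv 0) (ltl→qptl-renameL-⋀ₗ lift predictsNext) ϕ-holds)
             k (singleton-self k , unseen))
      where
      W = zipW (TS.Label T^P ∘ play k B) (TS.Label T^P ∘ t)
      π : Fin n → (Fin n ⊎ Fin c) × Fin 2
      π x = inj₁ x , zero
      lift : Fin n × Fin 2 → (Fin n ⊎ Fin c) × Fin 2
      lift (x , τ) = inj₁ x , τ
      predictsNext′ = ltl→qptl ∘ renameL lift ∘ predictsNext

      π-track : ∀ d x → W d (π x) ≡ singleton (visit k d) x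
      π-track zero    x = refl
      π-track (suc d) x = refl

      prophecy-correct : ∀ i j → W i (inj₂ j , zero) ≡ true ⇔ satQ W noEnv i (renameQ π (ξ j))
      prophecy-correct zero j = ⇔.trans
        (mk⇔ (trans (sym (B≈now j))) (trans (B≈now j)))
        (⇔.trans (does-true⇔ (table k j zero)) (⇔.sym (satQ-renameQ₀ π π-track (λ ()) (ξ j))))
      prophecy-correct (suc i) j = ⇔.trans
        (does-true⇔ (table k j (suc zero)))
        (⇔.sym (satQ-renameQ₀ π {p = suc i} {p′ = 1} (λ _ _ → refl) (λ ()) (ξ j)))

      constraint : Fin c → QPTL ((Fin n ⊎ Fin c) × Fin 2) 0
      constraint j = prop (inj₂ j , zero) ⇔q renameQ π (ξ j)

      prophecies-hold : ¬ Until 0 (const ⊤) (λ i → ¬ satQ W noEnv i (⋀q constraint))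
      prophecies-hold (i , _ , violated , _) =
        violated (from (satQ-⋀q constraint) λ j →
          satQ-⇔q (prop (inj₂ j , zero)) (renameQ π (ξ j)) (prophecy-correct i j))

    now-injective : ∀ k l → (∀ j → now k j ≡ now l j) → k ≡ l
    now-injective k l now-k≈now-l =
      singleton-unique (proj₁ (σ 0 (s₀ ∷ []))) (sees k λ _ → refl) (sees l now-k≈now-l)
      where
      s₀ = zero , now k
      σ = proj₁ (complete s₀ refl)
      sees : ∀ m → (∀ j → now k j ≡ now m j) → singleton (proj₁ (σ 0 (s₀ ∷ []))) m ≡ true
      sees m now-k≈now-m =
        let (_ , _ , sat) = proj₂ (complete s₀ refl) (play m (now k)) refl (λ _ → refl)
        in verifier-predicts m (now k) _ now-k≈now-m sat

  n≤2^c : n ≤ 2 ^ c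
  n≤2^c = decidable-stable (n ≤? 2 ^ c)
    (¬¬-map (λ table → pointwise-injective⇒≤2^ (now table) (now-injective table)) ¬¬truthTable)

complete-prophecies-Ω-log : (Ξ : (n : ℕ) → Prophecies n) →
  (∀ n → Complete (Tₙ n) (ϕₙ n) (Ξ n)) → OmegaLog (λ n → Prophecies.card (Ξ n))
complete-prophecies-Ω-log Ξ complete = 1 , 0 , λ n _ → let c = Prophecies.card (Ξ n) in begin
  ⌊log₂ n ⌋       ≤⟨ ⌊log₂⌋-mono-≤ (LowerBound.n≤2^c n (Ξ n) (complete n)) ⟩
  ⌊log₂ 2 ^ c ⌋   ≡⟨ ⌊log₂[2^n]⌋≡n c ⟩
  c               ≡⟨ *-identityˡ c ⟨
  1 * c           ∎
  where open ≤-Reasoning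

lemma3 : ∃ λ (a : ℕ → ℕ) →
         ∃ λ (T : (n : ℕ) → FTS (a n)) →
         ∃ λ (ϕ : (n : ℕ) → LTL (Fin (a n) × Fin 2)) →
           ThetaN (λ n → FTS.nStates (T n))
           × ((n : ℕ) → Safety (ϕ n))
           × ThetaN (λ n → sizeAE (ϕ n))
           × ((n : ℕ) → ModelsAE (toTS (T n)) (ϕ n))
           × ((Ξ : (n : ℕ) → Prophecies (a n)) →
              ((n : ℕ) → Complete (T n) (ϕ n) (Ξ n)) →
              OmegaLog (λ n → Prophecies.card (Ξ n)))
lemma3 =
  id , Tₙ , ϕₙ ,
  ThetaN-cong (λ n → cong suc (*-identityʳ n)) (ThetaN-affine 1 0) ,
  ϕₙ-safety ,
  ThetaN-cong (λ n → cong (2 +_) (sym (sizeL-⋀ₗ {m = n} predictsNext λ _ → refl)))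
              (ThetaN-affine 3 6) ,
  Tₙ⊨ϕₙ ,
  complete-prophecies-Ω-log
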